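{- Let $\phi$ be any $\mathsf{TML}$ formula, let $P_1,\dots,P_m$ be the predicate symbols occurring in $\phi$, and let $p_1,\dots,p_m,q$ be new propositions not occurring in $\phi$. Then for every non-empty countable set $D$: $\phi$ is satisfiable in an increasing (respectively, constant) agent model with agent set $D$ if and only if $q\land\mathsf{Tr}_2(\phi;q)$ is satisfiable in an increasing (respectively, constant) agent model with agent set $D$.
   Context: Term modal logic $\mathsf{TML}$ (relational vocabulary, no constants, no function symbols, no equality): formulas are $\phi::= P(\overline{x}) \mid \neg\phi \mid \phi\land\phi \mid \phi\lor\phi \mid \exists x\,\phi \mid \forall x\,\phi \mid \Box_x\phi \mid \Diamond_x\phi$ with $x$ a variable and $P$ a predicate symbol of arity $n$ applied to a vector of $n$ variables; propositions are predicate symbols of arity $0$. An increasing agent model is $M=(W,D,\delta,R,\rho)$ with $W$ a non-empty countable set of worlds, $D$ a non-empty countable set of agents, $R\subseteq W\times D\times W$, $\delta:W\to 2^D$ assigning non-empty local domains such that $(w,d,v)\in R$ implies $d\in\delta(w)\subseteq\delta(v)$, and $\rho(w,P)\subseteq\delta(w)^n$ for $P$ of arity $n$. It is a constant agent model if $\delta(w)=D$ for all $w$. Assignments $\sigma:\mathsf{Var}\to D$ are relevant at $w$ if their range lies in $\delta(w)$. For relevant $\sigma$: $M,w,\sigma\models P(x_1,\dots,x_n)$ iff $(\sigma(x_1),\dots,\sigma(x_n))\in\rho(w,P)$; Booleans as usual; $\exists x\,\phi$ holds iff $\phi$ holds under $\sigma[x\mapsto d]$ for some $d\in\delta(w)$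 (dually $\forall$); $\Box_x\phi$ holds iff $\phi$ holds at every $v$ with $(w,\sigma(x),v)\in R$ (dually $\Diamond_x$). A formula is satisfiable in a model if it holds at some world under some relevant assignment. The translation $\mathsf{Tr}_2(\cdot;q)$ is defined by: $\mathsf{Tr}_2(P_i(x_1,\dots,x_n);q)=\Diamond_{x_1}(\neg q\land\Diamond_{x_2}(\neg q\land\cdots\Diamond_{x_n}(\neg q\land p_i)\cdots))$; $\mathsf{Tr}_2(\neg\phi;q)=\neg\mathsf{Tr}_2(\phi;q)$; $\mathsf{Tr}_2(\phi\land\psi;q)=\mathsf{Tr}_2(\phi;q)\land\mathsf{Tr}_2(\psi;q)$; $\mathsf{Tr}_2(\Box_x\phi;q)=\Box_x(q\to\mathsf{Tr}_2(\phi;q))$; $\mathsf{Tr}_2(\exists x\,\phi;q)=\exists x\,\mathsf{Tr}_2(\phi;q)$ (other connectives treated via their standard definitions from these). -}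

module Defs where

open import Level using (0ℓ)
open import Data.Nat using (ℕ; _≟_)
open import Data.Vec using (Vec; []; _∷_; map)
open import Data.Vec.Relation.Unary.All using (All)

open import Data.Product using (Σ; _×_; _,_)
open import Data.Sum using (_⊎_)
open import Data.Empty using (⊥)
open import Relation.Nullary using (¬_; yes; no)
open import Relation.Binary.PropositionalEquality using (_≡_; _≢_)
open import Function.Definitions using (Injective)

-- Syntax of TML.
-- Variables are natural numbers.  A predicate symbol is a pair (n , i):
-- its arity n and its name i.  Propositions are the symbols of arity 0.

Var : Set
Var = ℕ

data Form : Set where
  atom  : (n i : ℕ) → Vec Var n → Form
  neg   : Form → Form
  and   : Form → Form → Form
  or    : Form → Form → Form
  ex    : Var → Form → Form
  all   : Var → Form → Form
  box   : Var → Form → Form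
  dia   : Var → Form → Form

prop : ℕ → Form
prop i = atom 0 i []

Occurs : ℕ → ℕ → Form → Set
Occurs n i (atom m j xs) = (n ≡ m) × (i ≡ j)
Occurs n i (neg φ)   = Occurs n i φ
Occurs n i (and φ ψ) = Occurs n i φ ⊎ Occurs n i ψ
Occurs n i (or φ ψ)  = Occurs n i φ ⊎ Occurs n i ψ
Occurs n i (ex x φ)  = Occurs n i φ
Occurs n i (all x φ) = Occurs n i φ
Occurs n i (box x φ) = Occurs n i φ
Occurs n i (dia x φ) = Occurs n i φ

-- The translation Tr₂(· ; q).
-- p n i is the name of the fresh proposition p_(n,i) replacing the
-- predicate symbol (n , i); q is the name of the fresh proposition q.
-- Derived connectives are translated via their standard definitions:
--   Tr₂(φ ∨ ψ) = Tr₂ φ ∨ Tr₂ ψ,  Tr₂(∀x φ) = ∀x Tr₂ φ,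
--   Tr₂(□ₓ φ) = □ₓ(q → Tr₂ φ) with (a → b) := (¬a ∨ b),
--   Tr₂(◇ₓ φ) = ◇ₓ(q ∧ Tr₂ φ).

chain : (q : ℕ) → ℕ → {n : ℕ} → Vec Var n → Form
chain q pi []       = prop pi
chain q pi (x ∷ xs) = dia x (and (neg (prop q)) (chain q pi xs))

Tr₂ : (p : ℕ → ℕ → ℕ) (q : ℕ) → Form → Form
Tr₂ p q (atom n i xs) = chain q (p n i) xs
Tr₂ p q (neg φ)   = neg (Tr₂ p q φ)
Tr₂ p q (and φ ψ) = and (Tr₂ p q φ) (Tr₂ p q ψ)
Tr₂ p q (or φ ψ)  = or (Tr₂ p q φ) (Tr₂ p q ψ)
Tr₂ p q (ex x φ)  = ex x (Tr₂ p q φ)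
Tr₂ p q (all x φ) = all x (Tr₂ p q φ)
Tr₂ p q (box x φ) = box x (or (neg (prop q)) (Tr₂ p q φ))
Tr₂ p q (dia x φ) = dia x (and (prop q) (Tr₂ p q φ))

Countable : Set → Set
Countable A = Σ (A → ℕ) (λ f → Injective _≡_ _≡_ f)

record Model (D : Set) : Set₁ where
  field
    W       : Set
    W-ne    : W
    W-count : Countable W
    δ       : W → D → Set
    δ-ne    : ∀ w → Σ D (δ w)
    R       : W → D → W → Set
    R-dom   : ∀ {w d v} → R w d v → δ w d
    R-inc   : ∀ {w d v} → R w d v → ∀ e → δ w e → δ v e
    ρ       : W → (n i : ℕ) → Vec D n → Set
    ρ-dom   : ∀ {w n i ds} → ρ w n i ds → All (δ w) ds

IsConstant : {D : Set} → Model D → Set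
IsConstant {D} M = ∀ w (d : D) → δ w d
  where open Model M

update : {D : Set} → (Var → D) → Var → D → (Var → D)
update σ x d y with x ≟ y
... | yes _ = d
... | no  _ = σ y

Relevant : {D : Set} (M : Model D) → Model.W M → (Var → D) → Set
Relevant M w σ = ∀ x → Model.δ M w (σ x)

Sat : {D : Set} (M : Model D) → Model.W M → (Var → D) → Form → Set
Sat M w σ (atom n i xs) = Model.ρ M w n i (map σ xs)
Sat M w σ (neg φ)   = ¬ Sat M w σ φ
Sat M w σ (and φ ψ) = Sat M w σ φ × Sat M w σ ψ
Sat M w σ (or φ ψ)  = Sat M w σ φ ⊎ Sat M w σ ψ
Sat M w σ (ex x φ)  = Σ _ λ d → Model.δ M w d × Sat M w (update σ x d) φ
Sat M w σ (all x φ) = ∀ d → Model.δ M w d → Sat M w (update σ x d) φ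
Sat M w σ (box x φ) = ∀ v → Model.R M w (σ x) v → Sat M v σ φ
Sat M w σ (dia x φ) = Σ _ λ v → Model.R M w (σ x) v × Sat M v σ φ

Satisfiable : {D : Set} → Model D → Form → Set
Satisfiable {D} M φ = Σ (Model.W M) λ w → Σ (Var → D) λ σ → Relevant M w σ × Sat M w σ φ

SatIncreasing : Set → Form → Set₁
SatIncreasing D φ = Σ (Model D) λ M → Satisfiable M φ

SatConstant : Set → Form → Set₁
SatConstant D φ = Σ (Model D) λ M → IsConstant M × Satisfiable M φ

Fresh : (p : ℕ → ℕ → ℕ) (q : ℕ) → Form → Set
Fresh p q φ =
  ¬ Occurs 0 q φ
  × (∀ n i → Occurs n i φ → ¬ Occurs 0 (p n i) φ × p n i ≢ q)
  × (∀ n i n' i' → Occurs n i φ → Occurs n' i' φ → p n i ≡ p n' i' → n ≡ n' × i ≡ i')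

module Submission where

-- Forward direction: given a model of φ, attach to every world w and every
-- finite sequence of agents d₁ … dₖ local to w a new world, reached from w
-- by following d₁, …, dₖ through worlds where q fails.  Then P(d₁, …, dₙ)
-- holds at w exactly when p holds at the end of the path for (d₁, …, dₙ),
-- while q singles out the original worlds, so the original accessibility
-- is the q-guarded one used by Tr₂.  Backward direction: in a model of
-- Tr₂ φ, read P(d₁, …, dₙ) at w as the path formula for p, and keep only
-- the accessibility steps into q-worlds.  Neither construction changes
-- local domains, so constant models stay constant.

open import Defs
open import Level using (0ℓ)
open import Axiom.ExcludedMiddle using (ExcludedMiddle)
open import Data.Nat using (ℕ; zero; suc; _≟_)
open import Data.Nat.Binary using (ℕᵇ; zero; 2[1+_]; 1+[2_]; toℕ)
open import Data.Nat.Binary.Properties using (toℕ-injective; 2[1+_]-injective; 1+[2_]-injective)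
open import Data.Product using (Σ; _×_; _,_; proj₁; proj₂; map₁)
open import Data.Product.Function.NonDependent.Propositional using (_×-⇔_)
open import Data.Sum using (inj₁; inj₂; [_,_]′)
open import Data.Sum.Function.Propositional using (_⊎-⇔_)
open import Data.Empty using (⊥; ⊥-elim)
open import Data.List as List using (List; []; _∷_; _++_; _∷ʳ_)
open import Data.List.Properties using (∷-injective; ∷-injectiveˡ; map-injective; ++-identityʳ; ++-conicalʳ; ∷ʳ-++)
open import Data.Vec using (Vec; []; _∷_; toList; map)
open import Data.Vec.Properties using (toList-injective)
open import Data.Vec.Relation.Binary.Equality.Cast using (cast-is-id)
open import Data.Vec.Relation.Unary.All using (All; []; universal)
open import Data.Vec.Relation.Unary.All.Properties using (map⁺)
open import Function using (_∘_; case_of_)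
open import Function.Bundles using (_⇔_; mk⇔; Equivalence)
open import Function.Definitions using (Injective)
open import Function.Properties.Equivalence using () renaming (sym to ⇔-sym; trans to ⇔-trans)
open import Function.Related.Propositional using (≡⇒)
open import Function.Related.TypeIsomorphisms using (¬-cong-⇔)
open import Relation.Nullary using (¬_; yes; no)
open import Relation.Binary.PropositionalEquality using (_≡_; _≢_; refl; cong; cong₂; subst)
  renaming (sym to ≡-sym; trans to ≡-trans)

open Equivalence using (to; from)

unary : ℕ → ℕᵇ → ℕᵇ
unary zero    b = b
unary (suc a) b = 1+[2 unary a b ]

-- Each entry is a run of 1+[2_] behind a 2[1+_] marker; since an encoding
-- never starts with 1+[2_], the end of the run is recognisable.
encodeᵇ : List ℕ → ℕᵇ
encodeᵇ []       = zero
encodeᵇ (a ∷ as) = 2[1+ unary a (encodeᵇ as) ]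

encodeᵇ-injective : Injective _≡_ _≡_ encodeᵇ
unary-encodeᵇ-injective : ∀ a b as bs →
  unary a (encodeᵇ as) ≡ unary b (encodeᵇ bs) → a ≡ b × as ≡ bs

encodeᵇ-injective {[]}     {[]}     _ = refl
encodeᵇ-injective {a ∷ as} {b ∷ bs} e
  with refl , refl ← unary-encodeᵇ-injective a b as bs (2[1+_]-injective e) = refl

unary-encodeᵇ-injective zero    zero    as       bs       e = refl , encodeᵇ-injective e
unary-encodeᵇ-injective zero    (suc b) []       bs       ()
unary-encodeᵇ-injective zero    (suc b) (_ ∷ _)  bs       ()
unary-encodeᵇ-injective (suc a) zero    as       []       ()
unary-encodeᵇ-injective (suc a) zero    as       (_ ∷ _)  ()
unary-encodeᵇ-injective (suc a) (suc b) as       bs       e =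
  map₁ (cong suc) (unary-encodeᵇ-injective a b as bs (1+[2_]-injective e))

ℕ-list-countable : Countable (List ℕ)
ℕ-list-countable = toℕ ∘ encodeᵇ , λ e → encodeᵇ-injective (toℕ-injective e)

List-countable : {A : Set} → Countable A → Countable (List A)
List-countable (f , f-injective) =
  proj₁ ℕ-list-countable ∘ List.map f ,
  λ e → map-injective f-injective (proj₂ ℕ-list-countable e)

×-countable : {A B : Set} → Countable A → Countable B → Countable (A × B)
×-countable {A} {B} (f , f-injective) (g , g-injective) = encode , injective
  where
  encode : A × B → ℕ
  encode (a , b) = proj₁ ℕ-list-countable (f a ∷ g b ∷ [])

  injective : Injective _≡_ _≡_ encode
  injective {a , b} {a′ , b′} e =
    let fa≡fa′ , gb∷[]≡gb′∷[] = ∷-injective (proj₂ ℕ-list-countable e)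
    in cong₂ _,_ (f-injective fa≡fa′) (g-injective (∷-injectiveˡ gb∷[]≡gb′∷[]))

toList-injective′ : {A : Set} {n : ℕ} (xs ys : Vec A n) → toList xs ≡ toList ys → xs ≡ ys
toList-injective′ xs ys e = ≡-trans (≡-sym (cast-is-id refl xs)) (toList-injective refl xs ys e)

Σ-⇔-bounded : {D : Set} {P A B : D → Set} → (∀ d → P d → A d ⇔ B d) →
              Σ D (λ d → P d × A d) ⇔ Σ D (λ d → P d × B d)
Σ-⇔-bounded A⇔B = mk⇔ (λ (d , h , a) → d , h , to (A⇔B d h) a)
                      (λ (d , h , b) → d , h , from (A⇔B d h) b)

Π-⇔-bounded : {D : Set} {P A B : D → Set} → (∀ d → P d → A d ⇔ B d) →
              (∀ d → P d → A d) ⇔ (∀ d → P d → B d)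
Π-⇔-bounded A⇔B = mk⇔ (λ f d h → to (A⇔B d h) (f d h))
                      (λ f d h → from (A⇔B d h) (f d h))

module _ {D : Set} (M : Model D) where
  open Model M

  relevant-update : ∀ {w σ d} x → Relevant M w σ → δ w d → Relevant M w (update σ x d)
  relevant-update x rel h y with x ≟ y
  ... | yes _ = h
  ... | no  _ = rel y

  relevant-R : ∀ {w d v σ} → R w d v → Relevant M w σ → Relevant M v σ
  relevant-R r rel y = R-inc r _ (rel y)

module Encode (p : ℕ → ℕ → ℕ) (q : ℕ) (Sym : ℕ → ℕ → Set)
              (p-injective : ∀ n i n′ i′ → Sym n i → Sym n′ i′ → p n i ≡ p n′ i′ → n ≡ n′ × i ≡ i′)
              (p≢q : ∀ n i → Sym n i → p n i ≢ q)
              {D : Set} (D-countable : Countable D) (M : Model D) where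
  open Model M

  -- Val w ds j: the proposition j holds at the world at the end of the path
  -- ds from w (the original world w itself when ds is empty).
  data Val : W → List D → ℕ → Set where
    q-root  : ∀ {w} → Val w [] q
    p-tuple : ∀ {w n i} (ds : Vec D n) → Sym n i → ρ w n i ds → Val w (toList ds) (p n i)

  data Step : W × List D → D → W × List D → Set where
    lift   : ∀ {w d v} → R w d v → Step (w , []) d (v , [])
    extend : ∀ {w ds d} → δ w d → Step (w , ds) d (w , ds ∷ʳ d)

  valuation : W × List D → (n i : ℕ) → Vec D n → Set
  valuation (w , ds) zero    j [] = Val w ds j
  valuation _        (suc n) _ _  = ⊥

  model : Model D
  model = record
    { W       = W × List D
    ; W-ne    = W-ne , []
    ; W-count = ×-countable W-count (List-countable D-countable)
    ; δ       = λ (w , _) → δ w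
    ; δ-ne    = λ (w , _) → δ-ne w
    ; R       = Step
    ; R-dom   = λ { (lift r) → R-dom r ; (extend h) → h }
    ; R-inc   = λ { (lift r) → R-inc r ; (extend _) _ h → h }
    ; ρ       = valuation
    ; ρ-dom   = λ { {n = zero} {ds = []} _ → [] ; {n = suc _} () }
    }

  constant : IsConstant M → IsConstant model
  constant c (w , _) = c w

  Val-q⇒root : ∀ {w ds j} → Val w ds j → j ≡ q → ds ≡ []
  Val-q⇒root q-root           _ = refl
  Val-q⇒root (p-tuple _ s _) e = ⊥-elim (p≢q _ _ s e)

  ¬Val-q-∷ʳ : ∀ {w d} ds → ¬ Val w (ds ∷ʳ d) q
  ¬Val-q-∷ʳ ds v = case ++-conicalʳ ds _ (Val-q⇒root v refl) of λ ()

  Val-p⇒ρ : ∀ {w n i ls j} {ds : Vec D n} → Sym n i →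
            Val w ls j → j ≡ p n i → ls ≡ toList ds → ρ w n i ds
  Val-p⇒ρ s q-root e _ = ⊥-elim (p≢q _ _ s (≡-sym e))
  Val-p⇒ρ {w} {ds = ds} s (p-tuple es s′ r) e e′
    with refl , refl ← p-injective _ _ _ _ s′ s e = subst (ρ w _ _) (toList-injective′ es ds e′) r

  sat-chain : ∀ j w ds {m} (xs : Vec Var m) {σ} → Relevant M w σ →
              Sat model (w , ds) σ (chain q j xs) ⇔ Val w (ds ++ toList (map σ xs)) j
  sat-chain j w ds []       _   = ≡⇒ (cong (λ l → Val w l j) (≡-sym (++-identityʳ ds)))
  sat-chain j w ds (x ∷ xs) {σ} rel = mk⇔ forward backward
    where
    further : Sat model (w , ds ∷ʳ σ x) σ (chain q j xs) ⇔ Val w (ds ++ σ x ∷ toList (map σ xs)) j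
    further = ⇔-trans (sat-chain j w (ds ∷ʳ σ x) xs rel)
                      (≡⇒ (cong (λ l → Val w l j) (∷ʳ-++ ds (σ x) (toList (map σ xs)))))

    forward : Sat model (w , ds) σ (chain q j (x ∷ xs)) → Val w (ds ++ σ x ∷ toList (map σ xs)) j
    forward (_ , lift _   , ¬q , _) = ⊥-elim (¬q q-root)
    forward (_ , extend _ , _  , s) = to further s

    backward : Val w (ds ++ σ x ∷ toList (map σ xs)) j → Sat model (w , ds) σ (chain q j (x ∷ xs))
    backward v = _ , extend (rel x) , ¬Val-q-∷ʳ ds , from further v

  sat-atom : ∀ {n i w σ} (xs : Vec Var n) → Sym n i → Relevant M w σ →
             ρ w n i (map σ xs) ⇔ Sat model (w , []) σ (chain q (p n i) xs)
  sat-atom xs s rel =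
    ⇔-trans (mk⇔ (p-tuple _ s) (λ v → Val-p⇒ρ s v refl refl))
            (⇔-sym (sat-chain _ _ [] xs rel))

  sat-encode : ∀ ψ → (∀ {n i} → Occurs n i ψ → Sym n i) → ∀ {w σ} → Relevant M w σ →
               Sat M w σ ψ ⇔ Sat model (w , []) σ (Tr₂ p q ψ)
  sat-encode (atom n i xs) syms rel = sat-atom xs (syms (refl , refl)) rel
  sat-encode (neg ψ)   syms rel = ¬-cong-⇔ (sat-encode ψ syms rel)
  sat-encode (and ψ χ) syms rel = sat-encode ψ (syms ∘ inj₁) rel ×-⇔ sat-encode χ (syms ∘ inj₂) rel
  sat-encode (or ψ χ)  syms rel = sat-encode ψ (syms ∘ inj₁) rel ⊎-⇔ sat-encode χ (syms ∘ inj₂) rel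
  sat-encode (ex x ψ)  syms rel = Σ-⇔-bounded λ _ h → sat-encode ψ syms (relevant-update M x rel h)
  sat-encode (all x ψ) syms rel = Π-⇔-bounded λ _ h → sat-encode ψ syms (relevant-update M x rel h)
  sat-encode (box x ψ) syms {w} {σ} rel = mk⇔ forward backward
    where
    IH : ∀ {v} → R w (σ x) v → Sat M v σ ψ ⇔ Sat model (v , []) σ (Tr₂ p q ψ)
    IH r = sat-encode ψ syms (relevant-R M r rel)

    forward : Sat M w σ (box x ψ) → Sat model (w , []) σ (Tr₂ p q (box x ψ))
    forward f _ (lift r)   = inj₂ (to (IH r) (f _ r))
    forward f _ (extend _) = inj₁ (¬Val-q-∷ʳ [])

    backward : Sat model (w , []) σ (Tr₂ p q (box x ψ)) → Sat M w σ (box x ψ)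
    backward f v r = [ (λ ¬q → ⊥-elim (¬q q-root)) , from (IH r) ]′ (f (v , []) (lift r))
  sat-encode (dia x ψ) syms {w} {σ} rel = mk⇔ forward backward
    where
    IH : ∀ {v} → R w (σ x) v → Sat M v σ ψ ⇔ Sat model (v , []) σ (Tr₂ p q ψ)
    IH r = sat-encode ψ syms (relevant-R M r rel)

    forward : Sat M w σ (dia x ψ) → Sat model (w , []) σ (Tr₂ p q (dia x ψ))
    forward (_ , r , s) = _ , lift r , q-root , to (IH r) s

    backward : Sat model (w , []) σ (Tr₂ p q (dia x ψ)) → Sat M w σ (dia x ψ)
    backward (_ , lift r   , _      , s) = _ , r , from (IH r) s
    backward (_ , extend _ , q-here , _) = ⊥-elim (¬Val-q-∷ʳ [] q-here)

  satisfiable : ∀ {φ} → (∀ {n i} → Occurs n i φ → Sym n i) →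
                Satisfiable M φ → Satisfiable model (and (prop q) (Tr₂ p q φ))
  satisfiable {φ} syms (w , σ , rel , s) = (w , []) , σ , rel , q-root , to (sat-encode φ syms rel) s

module Decode (em : ExcludedMiddle 0ℓ) (p : ℕ → ℕ → ℕ) (q : ℕ) {D : Set} (M : Model D) where
  open Model M

  Q : W → Set
  Q v = ρ v 0 q []

  Path : W → ℕ → ∀ {n} → Vec D n → Set
  Path w j []       = ρ w 0 j []
  Path w j (d ∷ ds) = Σ W λ v → R w d v × (¬ Q v × Path v j ds)

  model : Model D
  model = record
    { W       = W
    ; W-ne    = W-ne
    ; W-count = W-count
    ; δ       = δ
    ; δ-ne    = δ-ne
    ; R       = λ w d v → R w d v × Q v
    ; R-dom   = λ (r , _) → R-dom r
    ; R-inc   = λ (r , _) → R-inc r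
    ; ρ       = λ w n i ds → All (δ w) ds × Path w (p n i) ds
    ; ρ-dom   = proj₁
    }

  sat-chain : ∀ j w {m} (xs : Vec Var m) {σ} → Sat M w σ (chain q j xs) ⇔ Path w j (map σ xs)
  sat-chain j w []       = mk⇔ (λ s → s) (λ s → s)
  sat-chain j w (x ∷ xs) =
    mk⇔ (λ (v , r , ¬q , s) → v , r , ¬q , to   (sat-chain j v xs) s)
        (λ (v , r , ¬q , s) → v , r , ¬q , from (sat-chain j v xs) s)

  sat-decode : ∀ ψ {w σ} → Relevant M w σ → Sat model w σ ψ ⇔ Sat M w σ (Tr₂ p q ψ)
  sat-decode (atom n i xs) rel =
    mk⇔ (from (sat-chain _ _ xs) ∘ proj₂)
        (λ s → map⁺ (universal rel xs) , to (sat-chain _ _ xs) s)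
  sat-decode (neg ψ)   rel = ¬-cong-⇔ (sat-decode ψ rel)
  sat-decode (and ψ χ) rel = sat-decode ψ rel ×-⇔ sat-decode χ rel
  sat-decode (or ψ χ)  rel = sat-decode ψ rel ⊎-⇔ sat-decode χ rel
  sat-decode (ex x ψ)  rel = Σ-⇔-bounded λ _ h → sat-decode ψ (relevant-update M x rel h)
  sat-decode (all x ψ) rel = Π-⇔-bounded λ _ h → sat-decode ψ (relevant-update M x rel h)
  sat-decode (box x ψ) {w} {σ} rel = mk⇔ forward backward
    where
    IH : ∀ {v} → R w (σ x) v → Sat model v σ ψ ⇔ Sat M v σ (Tr₂ p q ψ)
    IH r = sat-decode ψ (relevant-R M r rel)

    forward : Sat model w σ (box x ψ) → Sat M w σ (Tr₂ p q (box x ψ))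
    forward f v r with em {Q v}
    ... | yes q-here = inj₂ (to (IH r) (f v (r , q-here)))
    ... | no  ¬q     = inj₁ ¬q

    backward : Sat M w σ (Tr₂ p q (box x ψ)) → Sat model w σ (box x ψ)
    backward f v (r , q-here) = [ (λ ¬q → ⊥-elim (¬q q-here)) , from (IH r) ]′ (f v r)
  sat-decode (dia x ψ) rel =
    mk⇔ (λ (v , (r , q-here) , s) → v , r , q-here , to   (sat-decode ψ (relevant-R M r rel)) s)
        (λ (v , r , q-here , s)   → v , (r , q-here) , from (sat-decode ψ (relevant-R M r rel)) s)

  satisfiable : ∀ {φ} → Satisfiable M (and (prop q) (Tr₂ p q φ)) → Satisfiable model φ
  satisfiable {φ} (w , σ , rel , _ , s) = w , σ , rel , from (sat-decode φ rel) s

-- Only injectivity of p on the symbols of φ and p n i ≢ q are needed: the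
-- conditions that q and the p n i do not occur in φ are unused, because Tr₂
-- replaces every atom of φ, propositions included.
lemma2 : ExcludedMiddle 0ℓ →
    (φ : Form) (p : ℕ → ℕ → ℕ) (q : ℕ) → Fresh p q φ →
    (D : Set) → D → Countable D →
    ((SatIncreasing D φ → SatIncreasing D (and (prop q) (Tr₂ p q φ)))
      × (SatIncreasing D (and (prop q) (Tr₂ p q φ)) → SatIncreasing D φ))
    × ((SatConstant D φ → SatConstant D (and (prop q) (Tr₂ p q φ)))
      × (SatConstant D (and (prop q) (Tr₂ p q φ)) → SatConstant D φ))
lemma2 em φ p q (_ , p-fresh , p-injective) D _ D-countable =
    ( (λ (M , s) → E.model M , E.satisfiable M {φ} (λ o → o) s)
    , (λ (M , s) → Dec.model M , Dec.satisfiable M {φ} s) )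
  , ( (λ (M , c , s) → E.model M , E.constant M c , E.satisfiable M {φ} (λ o → o) s)
    , (λ (M , c , s) → Dec.model M , c , Dec.satisfiable M {φ} s) )
  where
  module E (M : Model D) =
    Encode p q (λ n i → Occurs n i φ) p-injective (λ n i o → proj₂ (p-fresh n i o)) D-countable M
  module Dec (M : Model D) = Decode em p q M
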